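{- Let $G$ be a directed graph with $n$ vertices and let $J$ be a balanced joint SCC-decomposition of $G$ on a set $S\subseteq V(G)$. Then $J$ consists of $O(n)$ SCC-decompositions.
   Context: For a directed graph $H$ and a set of vertices $X$, $H[X]$ denotes the induced subgraph and $H\setminus X$ the graph with $X$ removed. An SCC-decomposition of a strongly connected graph $H$ is a rooted tree $T$ whose nodes form a partition of $V(H)$ such that, writing $H_\phi$ for the subgraph induced by the union of all descendants of node $\phi$ (including $\phi$): every internal node $\phi$ is a single vertex, and if $H_1,\dots,H_t$ are the SCCs of $H_\phi\setminus\phi$ then $\phi$ has exactly $t$ children $\phi_i$ with $H_{\phi_i}=H_i$. In a partial SCC-decomposition leaves need not be singletons. An SCC-decomposition of a graph that is not strongly connected is a collection of SCC-decompositions of its SCCs, counted as a single SCC-decomposition. For $S\subseteq V(H)$, a partial SCC-decomposition of $H$ with internal nodes $S$ has the singleton nodes $\{v\}$, $v\in S$, at the top, and every other node (an external node) is a leaf equal to the vertex set of an SCC of $H\setminus S$. A balanced joint SCC-decomposition of $G$ on $S$ ($|S|$ a power of 2) is defined recursively. If $S=\{r\}$, it is a partial SCC-decomposition of $G$ with internal nodes $\{r\}$ (one SCC-decomposition). If $|S|>1$, $S$ is split into equal halves $S_1,S_2$ and $J=(J_1,J_2,S,\Phi)$, where $J_i$ is a balanced joint SCC-decomposition of $G$ on $S_i$; each external node $\phi$ of $J_i$ (an SCC of $G\setminus S_i$) is extended by a partial SCC-decomposition $T_\phi$ of $G[\phi]$ with internal nodes $\phi\cap S$; the collection $\{T_\phi\}$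 over external nodes $\phi$ of $J_i$ counts as one SCC-decomposition (of $G\setminus S_i$); the external nodes of these extensions of $J_1$ and of $J_2$ coincide (they are the SCCs of $G\setminus S$) and form the shared set $\Phi$. The SCC-decompositions constituting $J$ are those of $J_1$, $J_2$ (recursively) and the two extensions. -}

module Defs where

open import Data.Nat using (ℕ; zero; suc; _+_; _^_)
open import Data.Fin using (Fin)
open import Data.Fin.Subset using (Subset; _∈_; _∉_; _⊆_; _∪_; _∩_; _─_; _-_; ⁅_⁆; ∣_∣; ⊤; ⊥; ⋃)
open import Data.List using (List; []; _∷_; map; _++_; concat)
open import Data.List.Relation.Unary.All using (All; []; _∷_)
open import Data.List.Relation.Unary.AllPairs using (AllPairs)
open import Data.List.Relation.Binary.Permutation.Propositional using (_↭_)
import Data.List.Membership.Propositional as LM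
open import Data.Product using (Σ; _×_; _,_; proj₁; ∃)
open import Function using (_⇔_)
open import Relation.Binary.PropositionalEquality using (_≡_; _≢_)
open import Relation.Nullary using (¬_)

Graph : ℕ → Set₁
Graph n = Fin n → Fin n → Set

module _ {n : ℕ} (G : Graph n) where

  data Path (X : Subset n) : Fin n → Fin n → Set where
    here : ∀ {u} → u ∈ X → Path X u u
    step : ∀ {u v w} → u ∈ X → G u v → Path X v w → Path X u w

  IsSCC : Subset n → Subset n → Set
  IsSCC X C =
    C ⊆ X
    × (∃ λ u → u ∈ C)
    × (∀ {u v} → u ∈ C → v ∈ C → Path X u v)
    × (∀ {u v} → u ∈ C → v ∈ X → Path X u v → Path X v u → v ∈ C)

  -- Rooted (rose) trees whose nodes are sets of vertices: an internal node is a
  -- single vertex, a leaf of a partial decomposition is an arbitrary vertex set.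
  data Tree : Set where
    leaf : Subset n → Tree
    node : Fin n → List Tree → Tree

  mutual
    vset : Tree → Subset n
    vset (leaf Y)    = Y
    vset (node v ts) = ⁅ v ⁆ ∪ vsets ts

    vsets : List Tree → Subset n
    vsets []       = ⊥
    vsets (t ∷ ts) = vset t ∪ vsets ts

  mutual
    internals : Tree → List (Fin n)
    internals (leaf _)    = []
    internals (node v ts) = v ∷ internalsF ts

    internalsF : List Tree → List (Fin n)
    internalsF []       = []
    internalsF (t ∷ ts) = internals t ++ internalsF ts

  mutual
    leaves : Tree → List (Subset n)
    leaves (leaf Y)    = Y ∷ []
    leaves (node v ts) = leavesF ts

    leavesF : List Tree → List (Subset n)
    leavesF []       = []
    leavesF (t ∷ ts) = leaves t ++ leavesF ts

  ChildrenOK : Subset n → List Tree → Set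
  ChildrenOK Y ts = All (λ t → IsSCC Y (vset t)) ts × AllPairs _≢_ (map vset ts)

  mutual
    ValidTree : Tree → Set
    ValidTree (leaf Y)    = ⊤'
      where open import Data.Unit renaming (⊤ to ⊤')
    ValidTree (node v ts) = ChildrenOK (vset (node v ts) - v) ts × ValidF ts

    ValidF : List Tree → Set
    ValidF []       = ⊤'
      where open import Data.Unit renaming (⊤ to ⊤')
    ValidF (t ∷ ts) = ValidTree t × ValidF ts

  IsPartialSCCDecomp : Subset n → List Tree → Set
  IsPartialSCCDecomp X F =
    All (λ t → IsSCC X (vset t)) F
    × AllPairs _≢_ (map vset F)
    × vsets F ≡ X
    × ValidF F

  IsPartialWithInternal : Subset n → Subset n → List Tree → Set
  IsPartialWithInternal X S F =
    IsPartialSCCDecomp X F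
    × (∀ v → (v LM.∈ internalsF F) ⇔ (v ∈ S))
    × All (IsSCC (X ─ S)) (leavesF F)

  Extension : Subset n → List (Subset n) → Set
  Extension S Φs = All (λ φ → Σ (List Tree) (IsPartialWithInternal φ (φ ∩ S))) Φs

  extLeaves : ∀ {S Φs} → Extension S Φs → List (Subset n)
  extLeaves []              = []
  extLeaves ((F , _) ∷ es)  = leavesF F ++ extLeaves es

  -- Balanced joint SCC-decomposition of G on S with |S| = 2^k.
  mutual
    data Joint : Subset n → ℕ → Set where
      single : (r : Fin n) (F : List Tree) → IsPartialWithInternal ⊤ ⁅ r ⁆ F →
               Joint ⁅ r ⁆ zero
      split  : ∀ {k} (S₁ S₂ : Subset n) →
               ∣ S₁ ∣ ≡ 2 ^ k → ∣ S₂ ∣ ≡ 2 ^ k → (∀ v → v ∈ S₁ → v ∉ S₂) →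
               (J₁ : Joint S₁ k) (J₂ : Joint S₂ k) →
               (e₁ : Extension (S₁ ∪ S₂) (externals J₁)) →
               (e₂ : Extension (S₁ ∪ S₂) (externals J₂)) →
               (Φ : List (Subset n)) → extLeaves e₁ ↭ Φ → extLeaves e₂ ↭ Φ →
               Joint (S₁ ∪ S₂) (suc k)

    externals : ∀ {S k} → Joint S k → List (Subset n)
    externals (single r F _)                       = leavesF F
    externals (split _ _ _ _ _ _ _ _ _ Φ _ _)      = Φ

  numDecomps : ∀ {S k} → Joint S k → ℕ
  numDecomps (single _ _ _)                          = 1
  numDecomps (split _ _ _ _ _ J₁ J₂ _ _ _ _ _)       = numDecomps J₁ + numDecomps J₂ + 2

module Submission where

open import Defs
open import Data.Nat using (ℕ; _*_; _≤_; _+_; _^_; suc; s≤s; z≤n)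
open import Data.Nat.Properties
  using (≤-refl; +-mono-≤; *-monoʳ-≤; *-assoc; m≤m+n; module ≤-Reasoning)
open import Data.Nat.Tactic.RingSolver using (solve-∀)
open import Data.Fin.Subset using (Subset)
open import Data.Fin.Subset.Properties using (∣p∣≤n)
open import Data.Product using (∃; _,_)
open import Relation.Binary.PropositionalEquality using (_≡_; subst; sym)

-- J is a full binary tree of depth k: its 2^k leaves contribute one decomposition
-- each and its 2^k − 1 splits two each, 3 · 2^k − 2 in all.
numDecomps+2≤3*2^k : ∀ {n} (G : Graph n) {S k} (J : Joint G S k) →
                     numDecomps G J + 2 ≤ 3 * 2 ^ k
numDecomps+2≤3*2^k G (single _ _ _) = ≤-refl
numDecomps+2≤3*2^k G (split {k} _ _ _ _ _ J₁ J₂ _ _ _ _ _) = begin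
    a + b + 2 + 2         ≡⟨ regroup a b ⟩
    (a + 2) + (b + 2)     ≤⟨ +-mono-≤ (numDecomps+2≤3*2^k G J₁) (numDecomps+2≤3*2^k G J₂) ⟩
    3 * 2 ^ k + 3 * 2 ^ k ≡⟨ double (2 ^ k) ⟩
    3 * (2 * 2 ^ k)       ∎
  where
  open ≤-Reasoning
  a = numDecomps G J₁
  b = numDecomps G J₂
  regroup : ∀ a b → a + b + 2 + 2 ≡ (a + 2) + (b + 2)
  regroup = solve-∀
  double : ∀ x → 3 * x + 3 * x ≡ 3 * (2 * x)
  double = solve-∀

-- Bounding |S| = 2^k by n would need the cardinality of a disjoint union;
-- the half S₁, with 2^(k-1) elements, already gives the bound up to a factor 2.
2^k≤2*n : ∀ {n} (G : Graph n) {S k} (J : Joint G S k) → 2 ^ k ≤ 2 * n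
2^k≤2*n {suc _} G (single _ _ _) = s≤s z≤n
2^k≤2*n G (split S₁ _ ∣S₁∣≡2^k _ _ _ _ _ _ _ _ _) =
  *-monoʳ-≤ 2 (subst (_≤ _) ∣S₁∣≡2^k (∣p∣≤n S₁))

lemma1 : ∃ λ (C : ℕ) → ∀ {n : ℕ} (G : Graph n) (S : Subset n) (k : ℕ) (J : Joint G S k) →
           numDecomps G J ≤ C * n
lemma1 = 6 , λ {n} G S k J → begin
    numDecomps G J     ≤⟨ m≤m+n _ 2 ⟩
    numDecomps G J + 2 ≤⟨ numDecomps+2≤3*2^k G J ⟩
    3 * 2 ^ k          ≤⟨ *-monoʳ-≤ 3 (2^k≤2*n G J) ⟩
    3 * (2 * n)        ≡⟨ sym (*-assoc 3 2 n) ⟩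
    6 * n              ∎
  where open ≤-Reasoning
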